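{- Let $m\ge1$, $n\ge0$. The inter-derivability relation $\{\langle\varphi,\psi\rangle:\varphi\vdash_{\mathcal{O}^m_n}\psi\text{ and }\psi\vdash_{\mathcal{O}^m_n}\varphi\}$ is a congruence of the formula algebra $\mathbf{Fm}$.
   Context: Language: binary $\land,\lor$, unary $\neg$, constants $\bot,\top$; $\mathbf{Fm}$ is the formula algebra over a countably infinite set of variables; $\neg^0\varphi=\varphi$, $\neg^{k+1}\varphi=\neg\neg^k\varphi$. $\vdash_{\mathcal{R}}$ denotes Hilbert derivability with substitution instances of rules in $\mathcal{R}$. Let $\mathsf{Eq}^m_n$ be the set of equations axiomatizing the Berman variety $\mathbb{O}^m_n$: the bounded distributive lattice axioms ($x\lor y\approx y\lor x$, $x\land y\approx y\land x$, $x\lor(y\lor z)\approx(x\lor y)\lor z$, $x\land(y\land z)\approx(x\land y)\land z$, $x\lor x\approx x$, $x\land x\approx x$, $x\lor(x\land y)\approx x$, $x\land(x\lor y)\approx x$, $x\land\bot\approx\bot$, $x\lor\top\approx\top$, $x\land(y\lor z)\approx(x\land y)\lor(x\land z)$), together with $\neg\bot\approx\top$, $\neg(x\lor y)\approx\neg x\land\neg y$, $\neg\top\approx\bot$, $\neg(x\land y)\approx\neg x\lor\neg y$, and $\neg^{2m+n}x\approx\neg^nx$. Let $\mathcal{R}^{\mathsf{Eq}^m_n}=\{\frac{\varphi}{\psi},\frac{\psi}{\varphi}:\varphi\approx\psi\in\mathsf{Eq}^m_n\}$ and $\mathcal{R}^{mn}_\land=\mathcal{R}^{\mathsf{Eq}^m_n}\cup\{\frac{p\land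 q}{p},\frac{p\land q}{q}\}$. For a rule $\mathsf{r}=\frac{\varphi}{\psi}$, a fresh variable $t$ not occurring in $\mathsf{r}$, and $k<\omega$, let $\mathsf{s}_k(\mathsf{r})=\frac{\neg^k\varphi\lor t}{\neg^k\psi\lor t}$ if $k$ is even and $\mathsf{s}_k(\mathsf{r})=\frac{\neg^k\psi\lor t}{\neg^k\varphi\lor t}$ if $k$ is odd. Then $\mathcal{O}^m_n=\mathcal{R}^{mn}_\land\cup\{\mathsf{s}_i(\mathsf{r}):i\le 2m+n,\ \mathsf{r}\in\mathcal{R}^{mn}_\land\}\cup\{\frac{p\,,\,q}{p\land q}\}$. -}

module Defs where

open import Data.Nat using (ℕ; zero; suc; _+_; _*_; _≤_)
open import Data.Bool using (Bool; true; false; not)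
open import Data.List using (List; []; _∷_)
open import Data.List.Membership.Propositional using (_∈_)
open import Data.Product using (_×_; _,_)
open import Relation.Binary.PropositionalEquality using (_≡_)
open import Relation.Binary.Structures using (IsEquivalence)
open import Relation.Nullary using (¬_)

data Fm : Set where
  var  : ℕ → Fm
  ⊥f   : Fm
  ⊤f   : Fm
  ¬f_  : Fm → Fm
  _∧f_ : Fm → Fm → Fm
  _∨f_ : Fm → Fm → Fm

infixr 6 _∧f_
infixr 5 _∨f_

¬^ : ℕ → Fm → Fm
¬^ zero φ = φ
¬^ (suc k) φ = ¬f (¬^ k φ)

Sub : Set
Sub = ℕ → Fm

_[_] : Fm → Sub → Fm
var x [ σ ] = σ x
⊥f [ σ ] = ⊥f
⊤f [ σ ] = ⊤f
(¬f φ) [ σ ] = ¬f (φ [ σ ])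
(φ ∧f ψ) [ σ ] = (φ [ σ ]) ∧f (ψ [ σ ])
(φ ∨f ψ) [ σ ] = (φ [ σ ]) ∨f (ψ [ σ ])

data Occ (t : ℕ) : Fm → Set where
  here : Occ t (var t)
  ¬o   : ∀ {φ} → Occ t φ → Occ t (¬f φ)
  ∧l   : ∀ {φ ψ} → Occ t φ → Occ t (φ ∧f ψ)
  ∧r   : ∀ {φ ψ} → Occ t ψ → Occ t (φ ∧f ψ)
  ∨l   : ∀ {φ ψ} → Occ t φ → Occ t (φ ∨f ψ)
  ∨r   : ∀ {φ ψ} → Occ t ψ → Occ t (φ ∨f ψ)

record Rule : Set where
  constructor _/_
  field
    prem  : List Fm
    concl : Fm
open Rule public

rule1 : Fm × Fm → Rule
rule1 (φ , ψ) = (φ ∷ []) / ψ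

data Der (R : Rule → Set) (Γ : Fm → Set) : Fm → Set where
  assum : ∀ {φ} → Γ φ → Der R Γ φ
  app   : (r : Rule) → R r → (σ : Sub) →
          (∀ {φ} → φ ∈ prem r → Der R Γ (φ [ σ ])) →
          Der R Γ (concl r [ σ ])

_⊢[_]_ : Fm → (Rule → Set) → Fm → Set
φ ⊢[ R ] ψ = Der R (λ χ → χ ≡ φ) ψ

x y z : Fm
x = var 0
y = var 1
z = var 2

Eq : ℕ → ℕ → List (Fm × Fm)
Eq m n =
  (x ∨f y , y ∨f x) ∷
  (x ∧f y , y ∧f x) ∷
  (x ∨f (y ∨f z) , (x ∨f y) ∨f z) ∷
  (x ∧f (y ∧f z) , (x ∧f y) ∧f z) ∷
  (x ∨f x , x) ∷
  (x ∧f x , x) ∷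
  (x ∨f (x ∧f y) , x) ∷
  (x ∧f (x ∨f y) , x) ∷
  (x ∧f ⊥f , ⊥f) ∷
  (x ∨f ⊤f , ⊤f) ∷
  (x ∧f (y ∨f z) , (x ∧f y) ∨f (x ∧f z)) ∷
  (¬f ⊥f , ⊤f) ∷
  (¬f (x ∨f y) , (¬f x) ∧f (¬f y)) ∷
  (¬f ⊤f , ⊥f) ∷
  (¬f (x ∧f y) , (¬f x) ∨f (¬f y)) ∷
  (¬^ (2 * m + n) x , ¬^ n x) ∷
  []

-- R^{mn}_∧ as a set of single-premise rules (pairs premise, conclusion)
data R∧ (m n : ℕ) : Fm × Fm → Set where
  eq→ : ∀ {φ ψ} → (φ , ψ) ∈ Eq m n → R∧ m n (φ , ψ)
  eq← : ∀ {φ ψ} → (φ , ψ) ∈ Eq m n → R∧ m n (ψ , φ)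
  ∧e₁ : R∧ m n (x ∧f y , x)
  ∧e₂ : R∧ m n (x ∧f y , y)

isEven : ℕ → Bool
isEven zero = true
isEven (suc k) = not (isEven k)

s : ℕ → ℕ → Fm × Fm → Fm × Fm
s k t (φ , ψ) with isEven k
... | true  = (¬^ k φ ∨f var t , ¬^ k ψ ∨f var t)
... | false = (¬^ k ψ ∨f var t , ¬^ k φ ∨f var t)

data O (m n : ℕ) : Rule → Set where
  base : ∀ {r} → R∧ m n r → O m n (rule1 r)
  sk   : ∀ {φ ψ} (i t : ℕ) → i ≤ 2 * m + n → R∧ m n (φ , ψ) →
         ¬ Occ t φ → ¬ Occ t ψ → O m n (rule1 (s i t (φ , ψ)))
  ∧i   : O m n ((x ∷ y ∷ []) / (x ∧f y))

-- congruence of the formula algebra (compatible with all operations;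
-- the constants are trivially compatible)
record IsCongruence (θ : Fm → Fm → Set) : Set where
  field
    isEquivalence : IsEquivalence θ
    ¬-cong : ∀ {φ φ'} → θ φ φ' → θ (¬f φ) (¬f φ')
    ∧-cong : ∀ {φ φ' ψ ψ'} → θ φ φ' → θ ψ ψ' → θ (φ ∧f ψ) (φ' ∧f ψ')
    ∨-cong : ∀ {φ φ' ψ ψ'} → θ φ φ' → θ ψ ψ' → θ (φ ∨f ψ) (φ' ∨f ψ')

InterDer : ℕ → ℕ → Fm → Fm → Set
InterDer m n φ ψ = (φ ⊢[ O m n ] ψ) × (ψ ⊢[ O m n ] φ)

-- Reflexivity, symmetry and transitivity are immediate, and ∧ is handled by ∧-elimination and
-- p , q / p ∧ q. For ∨ and ¬ call a rule A / B ∨-admissible when A ∨ U ⊢ B ∨ U for every U;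
-- instantiating U first by A and then by B and using x ∨ x ≈ x turns it back into derivability.
-- Every rule of O^m_n is ∨-admissible: s_k(r) absorbs U into its fresh disjunct t, the rules of
-- R∧ are the case k = 0, and p , q / p ∧ q follows by distributivity. Dually, if φ ⊢ ψ then
-- ¬ψ / ¬φ is ∨-admissible: by De Morgan, contraposing s_k(r) amounts to s_{k+1}(r), which is in
-- O^m_n for k < 2m + n; for k = 2m + n the equation ¬^{2m+n} x ≈ ¬^n x reduces it to s_{n+1}(r),
-- available because n + 1 ≤ 2m + n when m ≥ 1.

module Submission where

open import Defs
open import Data.Bool using (Bool; true; false; not; T; _∨_)
open import Data.Bool.Properties using (not-involutive; ∨-conicalˡ; ∨-conicalʳ)
open import Data.Fin using (#_)
open import Data.List using (lookup)
open import Data.List.Membership.Propositional.Properties using (∈-lookup)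
open import Data.List.Relation.Unary.All as All using (All; []; _∷_)
open import Data.List.Relation.Unary.Any using (here; there)
open import Data.Nat using (ℕ; zero; suc; _+_; _*_; _≤_; z≤n; s≤s; _≡ᵇ_)
open import Data.Nat.Properties using (_≟_; ≡⇒≡ᵇ; *-suc; m≤n⇒m<n∨m≡n; +-monoˡ-≤; ≤-trans; m≤m+n)
open import Data.Product using (_×_; _,_; proj₁; proj₂; map; swap; uncurry)
open import Data.Sum using (inj₁; inj₂)
open import Data.Empty using (⊥-elim)
open import Function using (_∘_)
open import Relation.Binary.PropositionalEquality using (_≡_; refl; sym; trans; cong; cong₂; subst; subst₂; module ≡-Reasoning)
open import Relation.Nullary using (¬_; yes; no)

cut : ∀ {R Γ Δ φ} → Der R Γ φ → (∀ {χ} → Γ χ → Der R Δ χ) → Der R Δ φ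
cut (assum γ) h = h γ
cut (app r r∈R σ prems) h = app r r∈R σ (λ φ∈ → cut (prems φ∈) h)

⊢-trans : ∀ {R φ ψ χ} → φ ⊢[ R ] ψ → ψ ⊢[ R ] χ → φ ⊢[ R ] χ
⊢-trans φ⊢ψ ψ⊢χ = cut ψ⊢χ (λ { refl → φ⊢ψ })

¬^-suc : ∀ k φ → ¬^ (suc k) φ ≡ ¬^ k (¬f φ)
¬^-suc zero φ = refl
¬^-suc (suc k) φ = cong ¬f_ (¬^-suc k φ)

¬^-[] : ∀ k φ σ → ¬^ k φ [ σ ] ≡ ¬^ k (φ [ σ ])
¬^-[] zero φ σ = refl
¬^-[] (suc k) φ σ = cong ¬f_ (¬^-[] k φ σ)

Occ-¬^ : ∀ k {t φ} → Occ t (¬^ k φ) → Occ t φ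
Occ-¬^ zero o = o
Occ-¬^ (suc k) (¬o o) = Occ-¬^ k o

isEven-2*m+n : ∀ m n → isEven (2 * m + n) ≡ isEven n
isEven-2*m+n zero n = refl
isEven-2*m+n (suc m) n = begin
  isEven (2 * suc m + n)          ≡⟨ cong (isEven ∘ (_+ n)) (*-suc 2 m) ⟩
  not (not (isEven (2 * m + n)))  ≡⟨ not-involutive _ ⟩
  isEven (2 * m + n)              ≡⟨ isEven-2*m+n m n ⟩
  isEven n                        ∎
  where open ≡-Reasoning

occurs : ℕ → Fm → Bool
occurs t (var v) = t ≡ᵇ v
occurs t ⊥f = false
occurs t ⊤f = false
occurs t (¬f φ) = occurs t φ
occurs t (φ ∧f ψ) = occurs t φ ∨ occurs t ψ
occurs t (φ ∨f ψ) = occurs t φ ∨ occurs t ψ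

occurs≡false⇒¬Occ : ∀ {t φ} → occurs t φ ≡ false → ¬ Occ t φ
occurs≡false⇒¬Occ {t} eq here = subst T eq (≡⇒≡ᵇ t t refl)
occurs≡false⇒¬Occ eq (¬o o) = occurs≡false⇒¬Occ eq o
occurs≡false⇒¬Occ eq (∧l o) = occurs≡false⇒¬Occ (∨-conicalˡ _ _ eq) o
occurs≡false⇒¬Occ eq (∧r o) = occurs≡false⇒¬Occ (∨-conicalʳ _ _ eq) o
occurs≡false⇒¬Occ eq (∨l o) = occurs≡false⇒¬Occ (∨-conicalˡ _ _ eq) o
occurs≡false⇒¬Occ eq (∨r o) = occurs≡false⇒¬Occ (∨-conicalʳ _ _ eq) o

Fresh : ℕ → Fm × Fm → Set
Fresh t (φ , ψ) = ¬ Occ t φ × ¬ Occ t ψ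

[]-agree : ∀ φ {σ τ : Sub} → (∀ {v} → Occ v φ → σ v ≡ τ v) → φ [ σ ] ≡ φ [ τ ]
[]-agree (var v) eq = eq here
[]-agree ⊥f eq = refl
[]-agree ⊤f eq = refl
[]-agree (¬f φ) eq = cong ¬f_ ([]-agree φ (eq ∘ ¬o))
[]-agree (φ ∧f ψ) eq = cong₂ _∧f_ ([]-agree φ (eq ∘ ∧l)) ([]-agree ψ (eq ∘ ∧r))
[]-agree (φ ∨f ψ) eq = cong₂ _∨f_ ([]-agree φ (eq ∘ ∨l)) ([]-agree ψ (eq ∘ ∨r))

_[_↦_] : Sub → ℕ → Fm → Sub
(σ [ t ↦ A ]) v with v ≟ t
... | yes _ = A
... | no _ = σ v

[↦]-same : ∀ σ t A → (σ [ t ↦ A ]) t ≡ A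
[↦]-same σ t A with t ≟ t
... | yes _ = refl
... | no t≢t = ⊥-elim (t≢t refl)

[↦]-fresh : ∀ {t} φ σ A → ¬ Occ t φ → φ [ σ [ t ↦ A ] ] ≡ φ [ σ ]
[↦]-fresh {t} φ σ A t∉φ = []-agree φ same
  where
  same : ∀ {v} → Occ v φ → (σ [ t ↦ A ]) v ≡ σ v
  same {v} v∈φ with v ≟ t
  ... | yes refl = ⊥-elim (t∉φ v∈φ)
  ... | no _ = refl

sub₃ : Fm → Fm → Fm → Sub
sub₃ A B C zero = A
sub₃ A B C (suc zero) = B
sub₃ A B C (suc (suc zero)) = C
sub₃ A B C (suc (suc (suc _))) = ⊥f

_[_]ₚ : Fm × Fm → Sub → Fm × Fm
(φ , ψ) [ σ ]ₚ = φ [ σ ] , ψ [ σ ]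

_∨ₚ_ : Fm × Fm → Fm → Fm × Fm
r ∨ₚ V = map (_∨f V) (_∨f V) r

contrapositive : Fm × Fm → Fm × Fm
contrapositive (φ , ψ) = ¬f ψ , ¬f φ

contrapositive^ : ℕ → Fm × Fm → Fm × Fm
contrapositive^ zero r = r
contrapositive^ (suc k) r = contrapositive (contrapositive^ k r)

contrapositive^-[] : ∀ k r σ → contrapositive^ k r [ σ ]ₚ ≡ contrapositive^ k (r [ σ ]ₚ)
contrapositive^-[] zero r σ = refl
contrapositive^-[] (suc k) r σ = cong contrapositive (contrapositive^-[] k r σ)

contrapositive^-fresh : ∀ k {t r} → Fresh t r → Fresh t (contrapositive^ k r)
contrapositive^-fresh zero fresh = fresh
contrapositive^-fresh (suc k) fresh with contrapositive^-fresh k fresh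
... | t∉φ , t∉ψ = (λ { (¬o o) → t∉ψ o }) , (λ { (¬o o) → t∉φ o })

orient : Bool → Fm → Fm → Fm × Fm
orient true φ ψ = φ , ψ
orient false φ ψ = ψ , φ

contrapositive^-orient : ∀ k φ ψ →
                         contrapositive^ k (φ , ψ) ≡ orient (isEven k) (¬^ k φ) (¬^ k ψ)
contrapositive^-orient zero φ ψ = refl
contrapositive^-orient (suc k) φ ψ =
  trans (cong contrapositive (contrapositive^-orient k φ ψ)) (contrapositive-orient (isEven k))
  where
  contrapositive-orient : ∀ p {A B} →
                          contrapositive (orient p A B) ≡ orient (not p) (¬f A) (¬f B)
  contrapositive-orient true = refl
  contrapositive-orient false = refl

s-orient : ∀ k t φ ψ → s k t (φ , ψ) ≡ orient (isEven k) (¬^ k φ) (¬^ k ψ) ∨ₚ var t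
s-orient k t φ ψ with isEven k
... | true = refl
... | false = refl

s-contrapositive^ : ∀ k t r → s k t r ≡ contrapositive^ k r ∨ₚ var t
s-contrapositive^ k t (φ , ψ) =
  trans (s-orient k t φ ψ) (cong (_∨ₚ var t) (sym (contrapositive^-orient k φ ψ)))

s-[] : ∀ k t r σ → s k t r [ σ ]ₚ ≡ contrapositive^ k (r [ σ ]ₚ) ∨ₚ σ t
s-[] k t r σ =
  trans (cong _[ σ ]ₚ (s-contrapositive^ k t r)) (cong (_∨ₚ σ t) (contrapositive^-[] k r σ))

module _ (m n : ℕ) where

  N : ℕ
  N = 2 * m + n

  infix 4 _⇒_ _⇒∨_ _⇔∨_
  infixr 5 _⨾_

  _⇒_ : Fm → Fm → Set₁
  A ⇒ B = ∀ {Γ} → Der (O m n) Γ A → Der (O m n) Γ B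

  _⇒∨_ : Fm → Fm → Set₁
  A ⇒∨ B = ∀ U → A ∨f U ⇒ B ∨f U

  _⇔∨_ : Fm → Fm → Set₁
  A ⇔∨ B = (A ⇒∨ B) × (B ⇒∨ A)

  ∨-Admissible : Fm × Fm → Set₁
  ∨-Admissible = uncurry _⇒∨_

  ⊢⇒ : ∀ {φ ψ} → φ ⊢[ O m n ] ψ → φ ⇒ ψ
  ⊢⇒ φ⊢ψ d = cut φ⊢ψ (λ { refl → d })

  ⇒⊢ : ∀ {φ ψ} → φ ⇒ ψ → φ ⊢[ O m n ] ψ
  ⇒⊢ φ⇒ψ = φ⇒ψ (assum refl)

  rule⇒ : ∀ {r} → O m n (rule1 r) → ∀ σ → proj₁ r [ σ ] ⇒ proj₂ r [ σ ]
  rule⇒ r∈O σ d = app _ r∈O σ (λ { (here refl) → d ; (there ()) })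

  ∧-intro : ∀ {Γ A B} → Der (O m n) Γ A → Der (O m n) Γ B → Der (O m n) Γ (A ∧f B)
  ∧-intro {A = A} {B} dA dB = app _ ∧i (sub₃ A B ⊥f) λ where
    (here refl) → dA
    (there (here refl)) → dB
    (there (there ()))

  fresh-disjunct-admissible : ∀ {t r} → O m n (rule1 (r ∨ₚ var t)) → Fresh t r →
                              ∀ σ → ∨-Admissible (r [ σ ]ₚ)
  fresh-disjunct-admissible {t} {P , Q} r∈O (t∉P , t∉Q) σ U d =
    subst (Der _ _) (instance-of Q t∉Q)
      (rule⇒ r∈O σ' (subst (Der _ _) (sym (instance-of P t∉P)) d))
    where
    σ' : Sub
    σ' = σ [ t ↦ U ]
    instance-of : ∀ φ → ¬ Occ t φ → (φ ∨f var t) [ σ' ] ≡ φ [ σ ] ∨f U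
    instance-of φ t∉φ = cong₂ _∨f_ ([↦]-fresh φ σ U t∉φ) ([↦]-same σ t U)

  -- The equations only mention x, y, z, so var 3 is fresh for every rule of R∧.
  Eq-fresh : All (Fresh 3) (Eq m n)
  Eq-fresh =
    computed refl refl ∷ computed refl refl ∷ computed refl refl ∷ computed refl refl ∷
    computed refl refl ∷ computed refl refl ∷ computed refl refl ∷ computed refl refl ∷
    computed refl refl ∷ computed refl refl ∷ computed refl refl ∷ computed refl refl ∷
    computed refl refl ∷ computed refl refl ∷ computed refl refl ∷
    (x-fresh ∘ Occ-¬^ N , x-fresh ∘ Occ-¬^ n) ∷ []
    where
    computed : ∀ {φ ψ} → occurs 3 φ ≡ false → occurs 3 ψ ≡ false → Fresh 3 (φ , ψ)
    computed eqφ eqψ = occurs≡false⇒¬Occ eqφ , occurs≡false⇒¬Occ eqψ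
    x-fresh : ¬ Occ 3 x
    x-fresh = occurs≡false⇒¬Occ refl

  R∧-fresh : ∀ {r} → R∧ m n r → Fresh 3 r
  R∧-fresh (eq→ e∈Eq) = All.lookup Eq-fresh e∈Eq
  R∧-fresh (eq← e∈Eq) = swap (All.lookup Eq-fresh e∈Eq)
  R∧-fresh ∧e₁ = occurs≡false⇒¬Occ refl , occurs≡false⇒¬Occ refl
  R∧-fresh ∧e₂ = occurs≡false⇒¬Occ refl , occurs≡false⇒¬Occ refl

  contrapositive^-admissible : ∀ {k r} → k ≤ N → R∧ m n r → ∀ σ →
                               ∨-Admissible (contrapositive^ k (r [ σ ]ₚ))
  contrapositive^-admissible {k} {r} k≤N r∈R σ =
    subst ∨-Admissible (contrapositive^-[] k r σ)
      (fresh-disjunct-admissible (subst (O m n ∘ rule1) (s-contrapositive^ k 3 r) sₖ)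
        (contrapositive^-fresh k (R∧-fresh r∈R)) σ)
    where
    sₖ : O m n (rule1 (s k 3 r))
    sₖ = sk k 3 k≤N r∈R (proj₁ (R∧-fresh r∈R)) (proj₂ (R∧-fresh r∈R))

  R∧⇒ : ∀ {r} → R∧ m n r → ∀ σ → proj₁ r [ σ ] ⇒ proj₂ r [ σ ]
  R∧⇒ r∈R = rule⇒ (base r∈R)

  R∧⇒∨ : ∀ {r} → R∧ m n r → ∀ σ → proj₁ r [ σ ] ⇒∨ proj₂ r [ σ ]
  R∧⇒∨ = contrapositive^-admissible z≤n

  eqn : ∀ k → R∧ m n (lookup (Eq m n) k)
  eqn k = eq→ (∈-lookup k)

  eqn⁻ : ∀ k → R∧ m n (swap (lookup (Eq m n) k))
  eqn⁻ k = eq← (∈-lookup k)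

  module ⇒ where

    ∨-comm : ∀ {A B} → A ∨f B ⇒ B ∨f A
    ∨-comm {A} {B} = R∧⇒ (eqn (# 0)) (sub₃ A B ⊥f)

    ∨-assoc : ∀ {A B C} → A ∨f (B ∨f C) ⇒ (A ∨f B) ∨f C
    ∨-assoc {A} {B} {C} = R∧⇒ (eqn (# 2)) (sub₃ A B C)

    ∨-assoc⁻ : ∀ {A B C} → (A ∨f B) ∨f C ⇒ A ∨f (B ∨f C)
    ∨-assoc⁻ {A} {B} {C} = R∧⇒ (eqn⁻ (# 2)) (sub₃ A B C)

    ∨-idem : ∀ {A} → A ∨f A ⇒ A
    ∨-idem {A} = R∧⇒ (eqn (# 4)) (sub₃ A ⊥f ⊥f)

    ∨-idem⁻ : ∀ {A} → A ⇒ A ∨f A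
    ∨-idem⁻ {A} = R∧⇒ (eqn⁻ (# 4)) (sub₃ A ⊥f ⊥f)

    ∧-distribˡ-∨ : ∀ {A B C} → A ∧f (B ∨f C) ⇒ (A ∧f B) ∨f (A ∧f C)
    ∧-distribˡ-∨ {A} {B} {C} = R∧⇒ (eqn (# 10)) (sub₃ A B C)

    ∧-elimˡ : ∀ {A B} → A ∧f B ⇒ A
    ∧-elimˡ {A} {B} = R∧⇒ ∧e₁ (sub₃ A B ⊥f)

    ∧-elimʳ : ∀ {A B} → A ∧f B ⇒ B
    ∧-elimʳ {A} {B} = R∧⇒ ∧e₂ (sub₃ A B ⊥f)

  ⇒∨-refl : ∀ {A} → A ⇒∨ A
  ⇒∨-refl U d = d

  _⨾_ : ∀ {A B C} → A ⇒∨ B → B ⇒∨ C → A ⇒∨ C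
  (A⇒B ⨾ B⇒C) U = B⇒C U ∘ A⇒B U

  ⇒∨⇒⇒ : ∀ {A B} → A ⇒∨ B → A ⇒ B
  ⇒∨⇒⇒ {A} {B} A⇒B = ⇒.∨-idem ∘ A⇒B B ∘ ⇒.∨-comm ∘ A⇒B A ∘ ⇒.∨-idem⁻

  ∨-monoˡ-⇒∨ : ∀ {A B} V → A ⇒∨ B → A ∨f V ⇒∨ B ∨f V
  ∨-monoˡ-⇒∨ V A⇒B U = ⇒.∨-assoc ∘ A⇒B (V ∨f U) ∘ ⇒.∨-assoc⁻

  ∨-monoʳ-⇒∨ : ∀ {A B} V → A ⇒∨ B → V ∨f A ⇒∨ V ∨f B
  ∨-monoʳ-⇒∨ V A⇒B U =
    ⇒.∨-comm ∘ ⇒.∨-assoc⁻ ∘ ⇒.∨-comm ∘ A⇒B (U ∨f V) ∘ ⇒.∨-comm ∘ ⇒.∨-assoc ∘ ⇒.∨-comm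

  ∨-mono-⇒∨ : ∀ {A A' B B'} → A ⇒∨ A' → B ⇒∨ B' → A ∨f B ⇒∨ A' ∨f B'
  ∨-mono-⇒∨ {A' = A'} {B} A⇒A' B⇒B' = ∨-monoˡ-⇒∨ B A⇒A' ⨾ ∨-monoʳ-⇒∨ A' B⇒B'

  module ⇒∨ where

    ∨-comm : ∀ {A B} → A ∨f B ⇒∨ B ∨f A
    ∨-comm {A} {B} = R∧⇒∨ (eqn (# 0)) (sub₃ A B ⊥f)

    ∧-comm : ∀ {A B} → A ∧f B ⇒∨ B ∧f A
    ∧-comm {A} {B} = R∧⇒∨ (eqn (# 1)) (sub₃ A B ⊥f)

    ∨-idem : ∀ {A} → A ∨f A ⇒∨ A
    ∨-idem {A} = R∧⇒∨ (eqn (# 4)) (sub₃ A ⊥f ⊥f)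

    ∧-idem : ∀ {A} → A ∧f A ⇒∨ A
    ∧-idem {A} = R∧⇒∨ (eqn (# 5)) (sub₃ A ⊥f ⊥f)

    ∨-absorbs-∧ : ∀ {A B} → A ∨f (A ∧f B) ⇒∨ A
    ∨-absorbs-∧ {A} {B} = R∧⇒∨ (eqn (# 6)) (sub₃ A B ⊥f)

    ∧-distribˡ-∨ : ∀ {A B C} → A ∧f (B ∨f C) ⇒∨ (A ∧f B) ∨f (A ∧f C)
    ∧-distribˡ-∨ {A} {B} {C} = R∧⇒∨ (eqn (# 10)) (sub₃ A B C)

    ¬-∨ : ∀ {A B} → ¬f (A ∨f B) ⇒∨ ¬f A ∧f ¬f B
    ¬-∨ {A} {B} = R∧⇒∨ (eqn (# 12)) (sub₃ A B ⊥f)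

    ¬-∨⁻ : ∀ {A B} → ¬f A ∧f ¬f B ⇒∨ ¬f (A ∨f B)
    ¬-∨⁻ {A} {B} = R∧⇒∨ (eqn⁻ (# 12)) (sub₃ A B ⊥f)

    ¬-∧ : ∀ {A B} → ¬f (A ∧f B) ⇒∨ ¬f A ∨f ¬f B
    ¬-∧ {A} {B} = R∧⇒∨ (eqn (# 14)) (sub₃ A B ⊥f)

    ∧-elimˡ : ∀ {A B} → A ∧f B ⇒∨ A
    ∧-elimˡ {A} {B} = R∧⇒∨ ∧e₁ (sub₃ A B ⊥f)

    ∧-elimʳ : ∀ {A B} → A ∧f B ⇒∨ B
    ∧-elimʳ {A} {B} = R∧⇒∨ ∧e₂ (sub₃ A B ⊥f)

  ∨-distribʳ-∧⁻ : ∀ {A B C} → (A ∨f C) ∧f (B ∨f C) ⇒ (A ∧f B) ∨f C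
  ∨-distribʳ-∧⁻ {A} {B} {C} =
    ⇒∨⇒⇒ (∨-monoʳ-⇒∨ (A ∧f B) ∨-absorbs-∧′) ∘ ⇒.∨-assoc⁻ ∘
    ⇒∨⇒⇒ (∨-mono-⇒∨ ∧-distribʳ-∨′ ∧-absorbs-∨′) ∘ ⇒.∧-distribˡ-∨
    where
    ∧-distribʳ-∨′ : (A ∨f C) ∧f B ⇒∨ (A ∧f B) ∨f (B ∧f C)
    ∧-distribʳ-∨′ = ⇒∨.∧-comm ⨾ ⇒∨.∧-distribˡ-∨ ⨾ ∨-monoˡ-⇒∨ (B ∧f C) ⇒∨.∧-comm
    ∧-absorbs-∨′ : (A ∨f C) ∧f C ⇒∨ C
    ∧-absorbs-∨′ =
      ⇒∨.∧-comm ⨾ ⇒∨.∧-distribˡ-∨ ⨾ ∨-monoʳ-⇒∨ (C ∧f A) ⇒∨.∧-idem ⨾ ⇒∨.∨-comm ⨾ ⇒∨.∨-absorbs-∧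
    ∨-absorbs-∧′ : B ∧f C ∨f C ⇒∨ C
    ∨-absorbs-∧′ = ⇒∨.∨-comm ⨾ ∨-monoʳ-⇒∨ C ⇒∨.∧-comm ⨾ ⇒∨.∨-absorbs-∧

  ∧-intro-⇒∨ : ∀ {A B C} → A ⇒∨ B → A ⇒∨ C → A ⇒∨ B ∧f C
  ∧-intro-⇒∨ A⇒B A⇒C U d = ∨-distribʳ-∧⁻ (∧-intro (A⇒B U d) (A⇒C U d))

  ∧-monoˡ-⇒∨ : ∀ {A B} V → A ⇒∨ B → A ∧f V ⇒∨ B ∧f V
  ∧-monoˡ-⇒∨ V A⇒B = ∧-intro-⇒∨ (⇒∨.∧-elimˡ ⨾ A⇒B) ⇒∨.∧-elimʳ

  ¬∨-monoˡ-⇒∨ : ∀ {A B} V → ¬f A ⇒∨ ¬f B → ¬f (A ∨f V) ⇒∨ ¬f (B ∨f V)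
  ¬∨-monoˡ-⇒∨ V ¬A⇒¬B = ⇒∨.¬-∨ ⨾ ∧-monoˡ-⇒∨ (¬f V) ¬A⇒¬B ⨾ ⇒∨.¬-∨⁻

  s-admissible : ∀ {k r} t → k ≤ N → R∧ m n r → ∀ σ → ∨-Admissible (s k t r [ σ ]ₚ)
  s-admissible {k} {r} t k≤N r∈R σ =
    subst ∨-Admissible (sym (s-[] k t r σ))
      (∨-monoˡ-⇒∨ (σ t) (contrapositive^-admissible k≤N r∈R σ))

  ⊢⇒⇒∨ : ∀ {φ ψ} → φ ⊢[ O m n ] ψ → φ ⇒∨ ψ
  ⊢⇒⇒∨ (assum refl) = ⇒∨-refl
  ⊢⇒⇒∨ (app _ (base r∈R) σ prems) =
    ⊢⇒⇒∨ (prems (here refl)) ⨾ R∧⇒∨ r∈R σ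
  ⊢⇒⇒∨ (app _ (sk k t k≤N r∈R _ _) σ prems) =
    ⊢⇒⇒∨ (prems (here refl)) ⨾ s-admissible t k≤N r∈R σ
  ⊢⇒⇒∨ (app _ ∧i σ prems) =
    ∧-intro-⇒∨ (⊢⇒⇒∨ (prems (here refl))) (⊢⇒⇒∨ (prems (there (here refl))))

  ∧-cong-⊢ : ∀ {φ φ' ψ ψ'} → φ ⊢[ O m n ] φ' → ψ ⊢[ O m n ] ψ' →
             (φ ∧f ψ) ⊢[ O m n ] (φ' ∧f ψ')
  ∧-cong-⊢ φ⊢φ' ψ⊢ψ' =
    ∧-intro (⊢⇒ φ⊢φ' (⇒.∧-elimˡ (assum refl))) (⊢⇒ ψ⊢ψ' (⇒.∧-elimʳ (assum refl)))

  ∨-cong-⊢ : ∀ {φ φ' ψ ψ'} → φ ⊢[ O m n ] φ' → ψ ⊢[ O m n ] ψ' →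
             (φ ∨f ψ) ⊢[ O m n ] (φ' ∨f ψ')
  ∨-cong-⊢ φ⊢φ' ψ⊢ψ' = ⇒⊢ (⇒∨⇒⇒ (∨-mono-⇒∨ (⊢⇒⇒∨ φ⊢φ') (⊢⇒⇒∨ ψ⊢ψ')))

  ¬^-period : ∀ A → ¬^ (suc n) A ⇔∨ ¬^ (suc N) A
  ¬^-period A = subst₂ _⇒∨_ (shift n) (shift N) (R∧⇒∨ (eqn⁻ (# 15)) σ)
              , subst₂ _⇒∨_ (shift N) (shift n) (R∧⇒∨ (eqn (# 15)) σ)
    where
    σ : Sub
    σ = sub₃ (¬f A) ⊥f ⊥f
    shift : ∀ k → ¬^ k x [ σ ] ≡ ¬^ (suc k) A
    shift k = trans (¬^-[] k x σ) (sym (¬^-suc k A))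

  orient-resp : ∀ p {A A' B B'} → A ⇔∨ A' → B ⇔∨ B' →
                ∨-Admissible (orient p A B) → ∨-Admissible (orient p A' B')
  orient-resp true (_ , A'⇒A) (B⇒B' , _) A⇒B = A'⇒A ⨾ A⇒B ⨾ B⇒B'
  orient-resp false (A⇒A' , _) (_ , B'⇒B) B⇒A = B'⇒B ⨾ B⇒A ⨾ A⇒A'

  contrapositive^-period : ∀ φ ψ → ∨-Admissible (contrapositive^ (suc n) (φ , ψ)) →
                           ∨-Admissible (contrapositive^ (suc N) (φ , ψ))
  contrapositive^-period φ ψ admissible =
    subst ∨-Admissible (sym (contrapositive^-orient (suc N) φ ψ))
      (subst (λ p → ∨-Admissible (orient p (¬^ (suc N) φ) (¬^ (suc N) ψ)))
             (cong not (sym (isEven-2*m+n m n)))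
        (orient-resp (isEven (suc n)) (¬^-period φ) (¬^-period ψ)
          (subst ∨-Admissible (contrapositive^-orient (suc n) φ ψ) admissible)))

  module _ (1≤m : 1 ≤ m) where

    suc-n≤N : suc n ≤ N
    suc-n≤N = +-monoˡ-≤ n (≤-trans 1≤m (m≤m+n m (m + 0)))

    contrapositive^-suc-admissible : ∀ {k r} → k ≤ N → R∧ m n r → ∀ σ →
                                     ∨-Admissible (contrapositive^ (suc k) (r [ σ ]ₚ))
    contrapositive^-suc-admissible k≤N r∈R σ with m≤n⇒m<n∨m≡n k≤N
    ... | inj₁ k<N = contrapositive^-admissible k<N r∈R σ
    ... | inj₂ refl = contrapositive^-period _ _ (contrapositive^-admissible suc-n≤N r∈R σ)

    s-contrapositive-admissible : ∀ {k r} t → k ≤ N → R∧ m n r → ∀ σ →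
                                  ∨-Admissible (contrapositive (s k t r [ σ ]ₚ))
    s-contrapositive-admissible {k} {r} t k≤N r∈R σ =
      subst (∨-Admissible ∘ contrapositive) (sym (s-[] k t r σ))
        (¬∨-monoˡ-⇒∨ (σ t) (contrapositive^-suc-admissible k≤N r∈R σ))

    ⊢-contrapose : ∀ {φ ψ} → φ ⊢[ O m n ] ψ → ¬f ψ ⇒∨ ¬f φ
    ⊢-contrapose (assum refl) = ⇒∨-refl
    ⊢-contrapose (app _ (base r∈R) σ prems) =
      contrapositive^-admissible (≤-trans (s≤s z≤n) suc-n≤N) r∈R σ
        ⨾ ⊢-contrapose (prems (here refl))
    ⊢-contrapose (app _ (sk k t k≤N r∈R _ _) σ prems) =
      s-contrapositive-admissible t k≤N r∈R σ ⨾ ⊢-contrapose (prems (here refl))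
    ⊢-contrapose (app _ ∧i σ prems) =
      ⇒∨.¬-∧
        ⨾ ∨-mono-⇒∨ (⊢-contrapose (prems (here refl))) (⊢-contrapose (prems (there (here refl))))
        ⨾ ⇒∨.∨-idem

    ¬-antimono-⊢ : ∀ {φ φ'} → φ ⊢[ O m n ] φ' → (¬f φ') ⊢[ O m n ] (¬f φ)
    ¬-antimono-⊢ = ⇒⊢ ∘ ⇒∨⇒⇒ ∘ ⊢-contrapose

lemma5p1 : (m n : ℕ) → 1 ≤ m → IsCongruence (InterDer m n)
lemma5p1 m n 1≤m = record
  { isEquivalence = record
    { refl = assum refl , assum refl
    ; sym = swap
    ; trans = λ (φ⊢ψ , ψ⊢φ) (ψ⊢χ , χ⊢ψ) → ⊢-trans φ⊢ψ ψ⊢χ , ⊢-trans χ⊢ψ ψ⊢φ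
    }
  ; ¬-cong = λ (φ⊢φ' , φ'⊢φ) → ¬-antimono-⊢ m n 1≤m φ'⊢φ , ¬-antimono-⊢ m n 1≤m φ⊢φ'
  ; ∧-cong = λ (φ⊢φ' , φ'⊢φ) (ψ⊢ψ' , ψ'⊢ψ) → ∧-cong-⊢ m n φ⊢φ' ψ⊢ψ' , ∧-cong-⊢ m n φ'⊢φ ψ'⊢ψ
  ; ∨-cong = λ (φ⊢φ' , φ'⊢φ) (ψ⊢ψ' , ψ'⊢ψ) → ∨-cong-⊢ m n φ⊢φ' ψ⊢ψ' , ∨-cong-⊢ m n φ'⊢φ ψ'⊢ψ
  }
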